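{- $\mathfrak{O}'\le\mathfrak{d}$.
   Context: A partition of $\omega$ is a set of pairwise disjoint nonempty subsets of $\omega$ (blocks) with union $\omega$. $(\omega)^\omega$ is the set of partitions with infinitely many blocks, $(\omega)^\omega_\infty$ those with at least one infinite block. For partitions $X,Y$, $X\sqcup Y$ is the finest partition each of whose blocks is a union of blocks of $X$ and a union of blocks of $Y$. $X_1,X_2\in(\omega)^\omega$ are orthogonal ($X_1\perp X_2$) if $X_1\sqcup X_2$ has the single block $\omega$. A family $\mathcal{O}\subseteq(\omega)^\omega$ is orthogonal$'$ if for every $X\in(\omega)^\omega_\infty$ there is $O\in\mathcal{O}$ with $O\perp X$; $\mathfrak{O}'$ is the least size of an orthogonal$'$ family. $\mathfrak{d}$ is the dominating number. -}

module Defs where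

open import Data.Nat using (ℕ; _≤_)
open import Data.Fin using (Fin)
open import Data.Product using (Σ; ∃; _×_)
open import Data.Sum using (_⊎_)
open import Relation.Nullary using (¬_)
open import Relation.Binary.PropositionalEquality using (_≡_)
open import Relation.Binary using (IsEquivalence)
open import Relation.Binary.Construct.Closure.ReflexiveTransitive using (Star)

-- A partition of ω, given by its equivalence relation "x and y lie in the same block".
-- (Blocks are the equivalence classes; they are automatically nonempty, disjoint, cover ω.)
record Partition : Set₁ where
  field
    _∼_   : ℕ → ℕ → Set
    isEqv : IsEquivalence _∼_
open Partition public

InfManyBlocks : Partition → Set
InfManyBlocks X = (n : ℕ) → Σ (Fin n → ℕ) λ a →
  (i j : Fin n) → _∼_ X (a i) (a j) → i ≡ j

HasInfBlock : Partition → Set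
HasInfBlock X = Σ ℕ λ a → (n : ℕ) → Σ ℕ λ m → (n ≤ m) × _∼_ X a m

InOmegaOmega : Partition → Set
InOmegaOmega X = InfManyBlocks X

InOmegaOmegaInf : Partition → Set
InOmegaOmegaInf X = InfManyBlocks X × HasInfBlock X

-- The relation of X ⊔ Y: the equivalence relation generated by the two relations
-- (finest partition whose blocks are unions of X-blocks and of Y-blocks).
Join : Partition → Partition → ℕ → ℕ → Set
Join X Y = Star (λ x y → _∼_ X x y ⊎ _∼_ Y x y)

Orthogonal : Partition → Partition → Set
Orthogonal X Y = (x y : ℕ) → Join X Y x y

IsOrthogonal' : {I : Set} → (I → Partition) → Set₁
IsOrthogonal' {I} O =
  ((i : I) → InOmegaOmega (O i)) ×
  ((X : Partition) → InOmegaOmegaInf X → Σ I λ i → Orthogonal (O i) X)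

IsDominating : {I : Set} → (I → ℕ → ℕ) → Set
IsDominating {I} D = (f : ℕ → ℕ) → Σ I λ i → Σ ℕ λ N → (n : ℕ) → N ≤ n → f n ≤ D i n

{-# OPTIONS --safe #-}
-- Given d, cut ω into consecutive intervals, the j-th starting at s_j and containing
-- [s_j, d s_j], and label the j-th interval by the j-th term of a sequence taking every
-- value infinitely often; O_d is the partition into label classes. If d dominates, from
-- N on, a function g picking points g n ≥ n of an infinite block A of X, then for any x
-- choose j ≥ N with the label of x: g s_j ∈ A lies in the j-th interval. So every point
-- is O_d-equivalent to a point of A, and any two points are joined through A.
module Submission where

open import Defs
open import Level using (0ℓ)
open import Axiom.ExcludedMiddle using (ExcludedMiddle)
open import Data.Nat using (ℕ; zero; suc; _+_; _∸_; _≤_; _<_; _≤′_; ≤′-refl; ≤′-step; _<?_; _≤?_; z≤n; s≤s; z<s)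
open import Data.Nat.Properties
open import Data.Product using (Σ; _×_; _,_; proj₁; proj₂)
open import Data.Sum using (inj₁; inj₂)
open import Data.Fin using (toℕ)
open import Data.Fin.Properties using (toℕ-injective)
open import Function using (_∘_)
open import Relation.Nullary using (yes; no; contradiction)
open import Relation.Binary using (IsEquivalence)
open import Relation.Binary.PropositionalEquality
open import Relation.Binary.Construct.Closure.ReflexiveTransitive using (ε; _◅_)

kernel : (ℕ → ℕ) → Partition
kernel f = record
  { _∼_   = λ x y → f x ≡ f y
  ; isEqv = record { refl = refl ; sym = sym ; trans = trans }
  }

kernel-infManyBlocks : (f s : ℕ → ℕ) → (∀ k → f (s k) ≡ k) →
                       InfManyBlocks (kernel f)
kernel-infManyBlocks f s f∘s≗id n =
  s ∘ toℕ , λ i j eq → toℕ-injective (trans (sym (f∘s≗id _)) (trans eq (f∘s≗id _)))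

kernel-orthogonal : (f : ℕ → ℕ) (X : Partition) (a : ℕ) →
                    (∀ x → Σ ℕ λ z → f x ≡ f z × _∼_ X a z) →
                    Orthogonal (kernel f) X
kernel-orthogonal f X a meets x y with meets x | meets y
... | z , fx≡fz , a∼z | w , fy≡fw , a∼w =
  inj₁ fx≡fz ◅ inj₂ (IsEquivalence.sym (isEqv X) a∼z) ◅ inj₂ a∼w ◅ inj₁ (sym fy≡fw) ◅ ε

module Intervals (b : ℕ → ℕ) (b-zero : b 0 ≡ 0) (b-step : ∀ j → b j < b (suc j)) where

  b-mono-≤ : ∀ {i j} → i ≤′ j → b i ≤ b j
  b-mono-≤ ≤′-refl     = ≤-refl
  b-mono-≤ (≤′-step p) = ≤-trans (b-mono-≤ p) (<⇒≤ (b-step _))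

  n≤b[n] : ∀ n → n ≤ b n
  n≤b[n] zero    = z≤n
  n≤b[n] (suc n) = ≤-<-trans (n≤b[n] n) (b-step n)

  interval : ℕ → ℕ
  interval zero = 0
  interval (suc x) with suc x <? b (suc (interval x))
  ... | yes _ = interval x
  ... | no  _ = suc (interval x)

  interval-bounds : ∀ x → b (interval x) ≤ x × x < b (suc (interval x))
  interval-bounds zero = subst (_≤ 0) (sym b-zero) z≤n , ≤-<-trans (n≤b[n] 0) (b-step 0)
  interval-bounds (suc x) with suc x <? b (suc (interval x)) | interval-bounds x
  ... | yes x+1<end | start≤x , _   = m≤n⇒m≤1+n start≤x , x+1<end
  ... | no  x+1≮end | _     , x<end =
    ≮⇒≥ x+1≮end , <-≤-trans (s≤s x<end) (b-step _)

  interval-order : ∀ {i j x} → b i ≤ x → x < b (suc j) → i ≤ j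
  interval-order {i} {j} bi≤x x<bj+1 with i ≤? j
  ... | yes i≤j = i≤j
  ... | no  i≰j = contradiction (≤-trans (b-mono-≤ (≤⇒≤′ (≰⇒> i≰j))) bi≤x) (<⇒≱ x<bj+1)

  interval-unique : ∀ {j x} → b j ≤ x → x < b (suc j) → interval x ≡ j
  interval-unique {x = x} bj≤x x<bj+1 =
    ≤-antisym (interval-order (proj₁ (interval-bounds x)) x<bj+1)
              (interval-order bj≤x (proj₂ (interval-bounds x)))

  offset : ℕ → ℕ
  offset x = x ∸ b (interval x)

triangle : ℕ → ℕ
triangle zero    = 0
triangle (suc m) = triangle m + suc m

module Triangles = Intervals triangle refl (λ m → m<m+n (triangle m) z<s)

-- The sequence 0; 0,1; 0,1,2; … of offsets within the triangular intervals.
sawtooth : ℕ → ℕ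
sawtooth = Triangles.offset

sawtooth-recurrent : ∀ k N → Σ ℕ λ j → N ≤ j × sawtooth j ≡ k
sawtooth-recurrent k N = triangle m + k , N≤j , offset≡k
  where
  open Triangles
  m = k + N
  interval≡m : interval (triangle m + k) ≡ m
  interval≡m = interval-unique (m≤m+n _ k) (+-monoʳ-< (triangle m) (s≤s (m≤m+n k N)))
  N≤j : N ≤ triangle m + k
  N≤j = ≤-trans (m≤n+m N k) (≤-trans (n≤b[n] m) (m≤m+n _ k))
  offset≡k : sawtooth (triangle m + k) ≡ k
  offset≡k = begin
    triangle m + k ∸ triangle (interval (triangle m + k)) ≡⟨ cong (λ i → triangle m + k ∸ triangle i) interval≡m ⟩
    triangle m + k ∸ triangle m                           ≡⟨ m+n∸m≡n (triangle m) k ⟩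
    k                                                     ∎
    where open ≡-Reasoning

module Stretched (d : ℕ → ℕ) where

  start : ℕ → ℕ
  start zero    = 0
  start (suc j) = suc (start j + d (start j))

  open Intervals start refl (λ j → s≤s (m≤m+n (start j) _)) public

  label : ℕ → ℕ
  label = sawtooth ∘ interval

  label-≡ : ∀ {j z} → start j ≤ z → z ≤ d (start j) → label z ≡ sawtooth j
  label-≡ sj≤z z≤d = cong sawtooth (interval-unique sj≤z (s≤s (≤-trans z≤d (m≤n+m _ _))))

  label-start : ∀ j → label (start j) ≡ sawtooth j
  label-start j = cong sawtooth (interval-unique ≤-refl (s≤s (m≤m+n (start j) _)))

labelPartition : (ℕ → ℕ) → Partition
labelPartition = kernel ∘ Stretched.label

labelPartition-infManyBlocks : ∀ d → InfManyBlocks (labelPartition d)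
labelPartition-infManyBlocks d = kernel-infManyBlocks label section label∘section≗id
  where
  open Stretched d
  section : ℕ → ℕ
  section k = start (proj₁ (sawtooth-recurrent k 0))
  label∘section≗id : ∀ k → label (section k) ≡ k
  label∘section≗id k =
    let j , _ , sawtooth[j]≡k = sawtooth-recurrent k 0 in trans (label-start j) sawtooth[j]≡k

labelPartition-orthogonal : ∀ d (X : Partition) (a : ℕ) (g : ℕ → ℕ) →
                            (∀ n → n ≤ g n × _∼_ X a (g n)) →
                            (N : ℕ) → (∀ n → N ≤ n → g n ≤ d n) →
                            Orthogonal (labelPartition d) X
labelPartition-orthogonal d X a g block N dominated = kernel-orthogonal label X a meets
  where
  open Stretched d
  meets : ∀ x → Σ ℕ λ z → label x ≡ label z × _∼_ X a z
  meets x with sawtooth-recurrent (label x) N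
  ... | j , N≤j , sawtooth[j]≡label[x] =
    g (start j) ,
    trans (sym sawtooth[j]≡label[x])
          (sym (label-≡ (proj₁ (block (start j)))
                        (dominated (start j) (≤-trans N≤j (n≤b[n] j))))) ,
    proj₂ (block (start j))

mainTheorem14 : ExcludedMiddle 0ℓ → (I : Set) → (D : I → ℕ → ℕ) → IsDominating D →
    Σ (I → Partition) λ O → IsOrthogonal' O
mainTheorem14 _ I D dominating =
  labelPartition ∘ D , labelPartition-infManyBlocks ∘ D , orthogonal
  where
  orthogonal : (X : Partition) → InOmegaOmegaInf X →
               Σ I λ i → Orthogonal (labelPartition (D i)) X
  orthogonal X (_ , a , unbounded) with dominating (proj₁ ∘ unbounded)
  ... | i , N , dominated = i , labelPartition-orthogonal (D i) X a (proj₁ ∘ unbounded)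
                                  (λ n → proj₂ (unbounded n)) N dominated
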